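{- Let $G$ be a strongly connected finite digraph and let $H$ be its undirectization. If $H$ has at least two cycles with at least one different vertex, then $G$ has at least two directed cycles with at least one different vertex.
   Context: The undirectization of $G=(V,E)$ is the undirected graph on $V$ with edges $\{(i,j):(i,j)\in E\text{ or }(j,i)\in E\}$. A cycle of an undirected graph is a closed path (vertices distinct except first = last) of length $\ge3$, up to cyclic permutation and inversion; a directed cycle of a digraph is such a closed path along directed edges, up to cyclic permutation. Two (directed) cycles have at least one different vertex if their vertex sets are distinct. -}

module Defs where

open import Data.Nat using (ℕ; _≤_)
open import Data.Fin using (Fin)
open import Data.Bool using (Bool; true; _∨_)
open import Data.List using (List; []; _∷_; length; _++_; [_])
open import Data.List.Relation.Unary.Unique.Propositional using (Unique)
open import Data.List.Relation.Unary.Linked using (Linked)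
open import Data.List.Membership.Propositional using (_∈_)
open import Data.Product using (_×_)
open import Data.Empty using (⊥)
open import Relation.Nullary using (¬_)
open import Relation.Binary.PropositionalEquality using (_≡_)
open import Relation.Binary.Construct.Closure.ReflexiveTransitive using (Star)
open import Function.Bundles using (_⇔_)

Digraph : ℕ → Set
Digraph n = Fin n → Fin n → Bool

DEdge : ∀ {n} → Digraph n → Fin n → Fin n → Set
DEdge G i j = G i j ≡ true

Undirectization : ∀ {n} → Digraph n → Fin n → Fin n → Bool
Undirectization G i j = G i j ∨ G j i

UEdge : ∀ {n} → Digraph n → Fin n → Fin n → Set
UEdge G i j = Undirectization G i j ≡ true

StronglyConnected : ∀ {n} → Digraph n → Set
StronglyConnected G = ∀ i j → Star (DEdge G) i j

-- A cycle w.r.t. an edge relation E, presented as the list of its vertices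
-- v₀ v₁ … v_{k-1} (the closed path v₀ v₁ … v_{k-1} v₀): length k ≥ 3,
-- vertices pairwise distinct, consecutive vertices (cyclically) joined by E.
-- For E = UEdge G this is a cycle of the undirectization; for E = DEdge G a
-- directed cycle of G.
IsCycle : ∀ {n} → (Fin n → Fin n → Set) → List (Fin n) → Set
IsCycle E []       = ⊥
IsCycle E (v ∷ vs) = (3 ≤ length (v ∷ vs)) × Unique (v ∷ vs) × Linked E (v ∷ vs ++ [ v ])

-- Two cycles have at least one different vertex: their vertex sets differ.
DifferentVertexSets : ∀ {n} → List (Fin n) → List (Fin n) → Set
DifferentVertexSets c d = ¬ (∀ v → (v ∈ c) ⇔ (v ∈ d))

-- An edge of an undirected cycle C of the undirectization is bidirected or one-way in G.
-- If all one-way edges of C point the same way around C, then C, or C reversed, is a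
-- directed cycle on the same vertex set.  Otherwise some bidirected segment a ⇝ b of C
-- (possibly a single vertex) is flanked by one-way edges p → a and q → b that both point
-- into it, or both out of it, which is the same situation in the reversed digraph.  By
-- strong connectivity p → a closes a directed cycle X through a and p, and q → b closes a
-- directed cycle Z that runs from b along the segment towards a before leaving it for good.
-- If X and Z have the same vertex set, then Z runs along the whole segment to a and only
-- then reaches p; cutting Z along the chord p → a gives a directed cycle missing q or b.
-- So every undirected cycle yields two directed cycles with different vertex sets or one
-- with its own vertex set, and two undirected cycles give the theorem.
module Submission where

open import Defs
open import Level using (Level; _⊔_; 0ℓ)
open import Data.Nat using (ℕ; _≤_; s≤s; z≤n)
open import Data.Fin using (Fin)
open import Data.Fin.Properties using (_≟_)
import Data.Bool as Bool
open import Data.Bool using (true; false)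
open import Data.List as List using (List; []; _∷_; _++_; [_]; length)
open import Data.List.Properties using (unfold-reverse; length-reverse)
open import Data.List.Relation.Unary.Any using (here; there)
open import Data.List.Relation.Unary.Any.Properties using (reverse⁺; reverse⁻)
open import Data.List.Relation.Unary.All as All using (All; []; _∷_)
import Data.List.Relation.Unary.All.Properties as Allₚ
open import Data.List.Relation.Unary.AllPairs using ([]; _∷_)
open import Data.List.Relation.Unary.Linked as Linked using (Linked; [-]; _∷_)
open import Data.List.Relation.Unary.Unique.Propositional using (Unique)
open import Data.List.Relation.Unary.Unique.Propositional.Properties using (++⁺)
open import Data.List.Relation.Binary.Disjoint.Propositional using (Disjoint)
open import Data.List.Relation.Binary.Subset.Propositional using (_⊆_)
open import Data.List.Membership.Propositional using (_∈_; _∉_)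
open import Data.List.Membership.Propositional.Properties using (∈-++⁺ˡ; ∈-++⁺ʳ; ∈-++⁻)
import Data.List.Membership.DecPropositional as DecMembership
open import Data.Product using (_×_; _,_; proj₁; proj₂; ∃; ∃₂)
open import Data.Sum as Sum using (_⊎_; inj₁; inj₂; [_,_]′)
open import Data.Empty using (⊥; ⊥-elim)
open import Function using (_∘_; flip; case_of_)
open import Function.Bundles using (_⇔_; mk⇔; Equivalence)
open import Function.Construct.Composition using (_⇔-∘_)
open import Function.Construct.Symmetry using (⇔-sym)
open import Relation.Nullary using (¬_; yes; no)
open import Relation.Binary.Core using (Rel; _⇒_)
open import Relation.Binary.Definitions using (Decidable; DecidableEquality)
open import Relation.Binary.PropositionalEquality using (_≡_; _≢_; refl; sym; subst)
open import Relation.Binary.Construct.Closure.ReflexiveTransitive as Star using (Star; ε; _◅_)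
open import Relation.Binary.Construct.Closure.Symmetric using (SymClosure; fwd; bwd)

private
  variable
    α ℓ : Level
    A : Set α

Unique-++⁻ˡ : ∀ (xs : List A) {ys} → Unique (xs ++ ys) → Unique xs
Unique-++⁻ˡ []       _        = []
Unique-++⁻ˡ (x ∷ xs) (x∉ ∷ u) = Allₚ.++⁻ˡ xs x∉ ∷ Unique-++⁻ˡ xs u

Unique-++⁻ʳ : ∀ (xs : List A) {ys} → Unique (xs ++ ys) → Unique ys
Unique-++⁻ʳ []       u       = u
Unique-++⁻ʳ (x ∷ xs) (_ ∷ u) = Unique-++⁻ʳ xs u

Unique-++⇒Disjoint : ∀ (xs : List A) {ys} → Unique (xs ++ ys) → Disjoint xs ys
Unique-++⇒Disjoint (x ∷ xs) (x∉ ∷ _) (here refl , v∈ys) =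
  Allₚ.All¬⇒¬Any (Allₚ.++⁻ʳ xs x∉) v∈ys
Unique-++⇒Disjoint (x ∷ xs) (_ ∷ u) (there v∈xs , v∈ys) =
  Unique-++⇒Disjoint xs u (v∈xs , v∈ys)

Unique-suffix : ∀ {z : A} xs {ys} → z ∈ xs → Unique (xs ++ ys) → Unique (z ∷ ys)
Unique-suffix xs z∈xs u =
  Allₚ.¬Any⇒All¬ _ (λ z∈ys → Unique-++⇒Disjoint xs u (z∈xs , z∈ys)) ∷ Unique-++⁻ʳ xs u

Unique-reverse : ∀ {xs : List A} → Unique xs → Unique (List.reverse xs)
Unique-reverse [] = []
Unique-reverse {xs = x ∷ xs} (x∉ ∷ u) =
  subst Unique (sym (unfold-reverse x xs))
    (++⁺ (Unique-reverse u) ([] ∷ []) λ { (v∈ , here refl) → Allₚ.All¬⇒¬Any x∉ (reverse⁻ v∈) })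

data Walk {A : Set α} (R : Rel A ℓ) : A → A → List A → Set (α ⊔ ℓ) where
  [-] : ∀ {x} → Walk R x x [ x ]
  _∷_ : ∀ {x y z l} → R x y → Walk R y z l → Walk R x z (x ∷ l)

module _ {R : Rel A ℓ} where

  head∈ : ∀ {x y l} → Walk R x y l → x ∈ l
  head∈ [-]     = here refl
  head∈ (_ ∷ _) = here refl

  last∈ : ∀ {x y l} → Walk R x y l → y ∈ l
  last∈ [-]     = here refl
  last∈ (_ ∷ w) = there (last∈ w)

  _++ʷ_ : ∀ {x y z l r} → Walk R x y l → Walk R y z (y ∷ r) → Walk R x z (l ++ r)
  [-]     ++ʷ w = w
  (e ∷ v) ++ʷ w = e ∷ (v ++ʷ w)

  splitAt : ∀ {x y z l} → Walk R x y l → z ∈ l →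
            ∃₂ λ l₁ l₂ → Walk R x z l₁ × Walk R z y (z ∷ l₂) × l ≡ l₁ ++ l₂
  splitAt [-]     (here refl)  = _ , [] , [-] , [-] , refl
  splitAt [-]     (there ())
  splitAt (e ∷ w) (here refl)  = _ , _ , [-] , e ∷ w , refl
  splitAt (e ∷ w) (there z∈l) with splitAt w z∈l
  ... | l₁ , l₂ , w₁ , w₂ , refl = _ ∷ l₁ , l₂ , e ∷ w₁ , w₂ , refl

  loop-unique : ∀ {x l} → Walk R x x l → Unique l → l ≡ [ x ]
  loop-unique [-]     _        = refl
  loop-unique (_ ∷ w) (x∉ ∷ _) = ⊥-elim (Allₚ.All¬⇒¬Any x∉ (last∈ w))

  Walk⇒Linked : ∀ {x y z l} → Walk R x y l → R y z → Linked R (l ++ [ z ])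
  Walk⇒Linked [-]               e′ = e′ ∷ [-]
  Walk⇒Linked (e ∷ [-])         e′ = e ∷ e′ ∷ [-]
  Walk⇒Linked (e ∷ w@(_ ∷ _))   e′ = e ∷ Walk⇒Linked w e′

  Linked⇒Walk : ∀ {x z} xs → Linked R (x ∷ xs ++ [ z ]) → ∃ λ y → Walk R x y (x ∷ xs) × R y z
  Linked⇒Walk []       (e ∷ [-]) = _ , [-] , e
  Linked⇒Walk (_ ∷ xs) (e ∷ lk) with Linked⇒Walk xs lk
  ... | y , w , e′ = y , e ∷ w , e′

mapʷ : ∀ {R S : Rel A ℓ} → R ⇒ S → ∀ {x y l} → Walk R x y l → Walk S x y l
mapʷ f [-]     = [-]
mapʷ f (e ∷ w) = f e ∷ mapʷ f w

reverseʷ : ∀ {R : Rel A ℓ} {x y l} → Walk (flip R) x y l → Walk R y x (List.reverse l)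
reverseʷ [-] = [-]
reverseʷ {R = R} {x} {l = _ ∷ l} (e ∷ w) =
  subst (Walk R _ x) (sym (unfold-reverse x l)) (reverseʷ w ++ʷ (e ∷ [-]))

module _ (_≟ᴬ_ : DecidableEquality A) {R : Rel A ℓ} where

  open DecMembership _≟ᴬ_ using (_∈?_)

  simplify : ∀ {x y} → Star R x y → ∃ λ l → Walk R x y l × Unique l
  simplify ε = _ , [-] , [] ∷ []
  simplify {x} (e ◅ s) with simplify s
  ... | l , w , u with x ∈? l
  ...   | no x∉l = x ∷ l , e ∷ w , Allₚ.¬Any⇒All¬ l x∉l ∷ u
  ...   | yes x∈l with splitAt w x∈l
  ...     | l₁ , l₂ , w₁ , w₂ , refl = x ∷ l₂ , w₂ , Unique-suffix l₁ (last∈ w₁) u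

  lastVisit : (S : List A) → ∀ {x y l} → Walk R x y l → Unique l →
              All (_∉ S) l ⊎ ∃₂ λ z r → z ∈ S × Walk R z y (z ∷ r) × Unique (z ∷ r) × All (_∉ S) r
  lastVisit S {x} [-] u with x ∈? S
  ... | yes x∈S = inj₂ (x , [] , x∈S , [-] , u , [])
  ... | no  x∉S = inj₁ (x∉S ∷ [])
  lastVisit S {x} (e ∷ w) u@(_ ∷ u′) with lastVisit S w u′
  ... | inj₂ later = inj₂ later
  ... | inj₁ avoids with x ∈? S
  ...   | yes x∈S = inj₂ (x , _ , x∈S , e ∷ w , u , avoids)
  ...   | no  x∉S = inj₁ (x∉S ∷ avoids)

  -- Follow the spine up to the last spine vertex on a simple walk b ⇝ q, then that walk.
  -- The result meets a only where it leaves the spine for good.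
  detour : ∀ {a b q N} → Walk R b a N → Unique N → Star R b q →
           ∃ λ L → Walk R b q L × Unique L ×
             (a ∈ L → ∃ λ r → Walk R a q (a ∷ r) × Unique (a ∷ r) × All (_∉ N) r ×
                              (∀ {v} → v ∈ L → v ∉ N → v ∈ r))
  detour {a} {N = N} spine uN s with simplify s
  ... | _ , walk , u with lastVisit N walk u
  ... | inj₁ avoids = ⊥-elim (All.lookup avoids (head∈ walk) (head∈ spine))
  ... | inj₂ (z , r , z∈N , toQ , uz@(_ ∷ ur) , r∉N) with splitAt spine z∈N
  ... | N₁ , N₂ , toZ , fromZ , refl = N₁ ++ r , toZ ++ʷ toQ , uL , reach
    where
    uL : Unique (N₁ ++ r)
    uL = ++⁺ (Unique-++⁻ˡ N₁ uN) ur λ (v∈N₁ , v∈r) →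
           All.lookup r∉N v∈r (∈-++⁺ˡ v∈N₁)

    off-spine : ∀ {v} → v ∈ N₁ ++ r → v ∉ N₁ ++ N₂ → v ∈ r
    off-spine v∈L v∉N with ∈-++⁻ N₁ v∈L
    ... | inj₁ v∈N₁ = ⊥-elim (v∉N (∈-++⁺ˡ v∈N₁))
    ... | inj₂ v∈r  = v∈r

    reach : a ∈ N₁ ++ r →
            ∃ λ r′ → Walk R a _ (a ∷ r′) × Unique (a ∷ r′) × All (_∉ N₁ ++ N₂) r′ ×
                     (∀ {v} → v ∈ N₁ ++ r → v ∉ N₁ ++ N₂ → v ∈ r′)
    reach a∈L with ∈-++⁻ N₁ a∈L
    ... | inj₂ a∈r = ⊥-elim (All.lookup r∉N a∈r (last∈ spine))
    ... | inj₁ a∈N₁ with last∈ fromZ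
    ...   | there a∈N₂ = ⊥-elim (Unique-++⇒Disjoint N₁ uN (a∈N₁ , a∈N₂))
    ...   | here refl  = r , toQ , uz , r∉N , off-spine

Both OneWay : {A : Set α} → Rel A ℓ → Rel A ℓ
Both   R x y = R x y × R y x
OneWay R x y = R x y × ¬ R y x

data Orientation {A : Set α} (R : Rel A ℓ) (x y : A) : Set ℓ where
  both    : Both R x y → Orientation R x y
  along   : OneWay R x y → Orientation R x y
  against : OneWay (flip R) x y → Orientation R x y

module _ {R : Rel A ℓ} where

  Orientation-flip : ∀ {x y} → Orientation R x y → Orientation (flip R) x y
  Orientation-flip (both (xy , yx)) = both (yx , xy)
  Orientation-flip (along e)        = against e
  Orientation-flip (against e)      = along e

  orient : Decidable R → ∀ {x y} → SymClosure R x y → Orientation R x y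
  orient R? {x} {y} e with R? x y | R? y x | e
  ... | yes xy | yes yx | _     = both (xy , yx)
  ... | yes xy | no ¬yx | _     = along (xy , ¬yx)
  ... | no ¬xy | yes yx | _     = against (yx , ¬xy)
  ... | no ¬xy | no _   | fwd xy = ⊥-elim (¬xy xy)
  ... | no _   | no ¬yx | bwd yx = ⊥-elim (¬yx yx)

data Oriented {A : Set α} (R : Rel A ℓ) (x z : A) : List A → Set (α ⊔ ℓ) where
  oriented : ∀ {b w M l} → Walk (Both R) x b M → OneWay R b w → Walk R w z l →
             Oriented R x z (M ++ l)

Oriented⇒Walk : ∀ {R : Rel A ℓ} {x z l} → Oriented R x z l → Walk R x z l
Oriented⇒Walk (oriented seg (bw , _) rest) = mapʷ proj₁ seg ++ʷ (bw ∷ rest)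

module _ {n : ℕ} where

  open DecMembership (_≟_ {n}) using (_∈?_)

  SameVertices : Rel (List (Fin n)) 0ℓ
  SameVertices c d = ∀ v → (v ∈ c) ⇔ (v ∈ d)

  SameVertices-refl : ∀ {c} → SameVertices c c
  SameVertices-refl _ = mk⇔ (λ v∈ → v∈) (λ v∈ → v∈)

  SameVertices-reverse : ∀ {c} → SameVertices c (List.reverse c)
  SameVertices-reverse _ = mk⇔ reverse⁺ reverse⁻

  different : ∀ {v : Fin n} {c d} → v ∈ c → v ∉ d → DifferentVertexSets c d
  different v∈c v∉d same = v∉d (Equivalence.to (same _) v∈c)

  different-or-⊆ : ∀ c d → DifferentVertexSets c d ⊎ c ⊆ d
  different-or-⊆ c d with All.all? (_∈? d) c
  ... | yes c⊆d = inj₂ (All.lookup c⊆d)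
  ... | no  c⊈d = inj₁ λ same → c⊈d (All.tabulate (Equivalence.to (same _)))

  DifferentVertexSets-resp : ∀ {c c′ d d′} → SameVertices c c′ → SameVertices d d′ →
                             DifferentVertexSets c d → DifferentVertexSets c′ d′
  DifferentVertexSets-resp c~c′ d~d′ c≠d same =
    c≠d λ v → ⇔-sym (d~d′ v) ⇔-∘ (same v ⇔-∘ c~c′ v)

  TwoCycles : Rel (Fin n) 0ℓ → Set
  TwoCycles R = ∃₂ λ c d → IsCycle R c × IsCycle R d × DifferentVertexSets c d

  IsCycle-map : ∀ {R S : Rel (Fin n) 0ℓ} → R ⇒ S → ∀ {c} → IsCycle R c → IsCycle S c
  IsCycle-map f {_ ∷ _} (len , u , lk) = len , u , Linked.map f lk

  module _ {R : Rel (Fin n) 0ℓ} where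

    IsCycle-close : ∀ {x y l} → Walk R x y l → Unique l → 3 ≤ length l → R y x → IsCycle R l
    IsCycle-close w@[-]     u len e = len , u , Walk⇒Linked w e
    IsCycle-close w@(_ ∷ _) u len e = len , u , Walk⇒Linked w e

    3≤length : ∀ {x y l} → Walk R x y l → x ≢ y → ¬ R x y → 3 ≤ length l
    3≤length [-]             x≢x _  = ⊥-elim (x≢x refl)
    3≤length (e ∷ [-])       _   ¬e = ⊥-elim (¬e e)
    3≤length (_ ∷ _ ∷ [-])   _   _  = s≤s (s≤s (s≤s z≤n))
    3≤length (_ ∷ _ ∷ _ ∷ _) _   _  = s≤s (s≤s (s≤s z≤n))

    IsCycle-oneWay : ∀ {x y l} → Walk R x y l → Unique l → x ≢ y → OneWay R y x → IsCycle R l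
    IsCycle-oneWay w u x≢y (yx , ¬xy) = IsCycle-close w u (3≤length w x≢y ¬xy) yx

    IsCycle-flip : ∀ {c} → IsCycle (flip R) c → IsCycle R (List.reverse c)
    IsCycle-flip {x ∷ xs} (len , u , lk) with Linked⇒Walk xs lk
    ... | _ , w , e = IsCycle-close (reverseʷ w) (Unique-reverse u)
                        (subst (3 ≤_) (sym (length-reverse (x ∷ xs))) len) e

    TwoCycles-flip : TwoCycles (flip R) → TwoCycles R
    TwoCycles-flip (c , d , c-cycle , d-cycle , c≠d) =
      List.reverse c , List.reverse d , IsCycle-flip c-cycle , IsCycle-flip d-cycle ,
      DifferentVertexSets-resp SameVertices-reverse SameVertices-reverse c≠d

  -- The spine is a bidirected segment a ⇝ b of an undirected cycle, traversed backwards.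
  record Converging (R : Rel (Fin n) 0ℓ) : Set where
    constructor converging
    field
      {p a b q}     : Fin n
      {spine}       : List (Fin n)
      walk          : Walk R b a spine
      unique        : Unique spine
      p∉spine       : p ∉ spine
      q∉spine       : q ∉ spine
      into-a        : OneWay R p a
      into-b        : OneWay R q b
      nondegenerate : p ≢ q ⊎ a ≢ b

  module _ {R : Rel (Fin n) 0ℓ} (strong : ∀ x y → Star R x y) (c : Converging R) where

    open Converging c

    private
      a≢p : a ≢ p
      a≢p refl = p∉spine (last∈ walk)

      b≢q : b ≢ q
      b≢q refl = q∉spine (head∈ walk)

      shortcut : ∀ {L r} → Walk R a q (a ∷ r) → Unique (a ∷ r) → All (_∉ spine) r →
                 (∀ {v} → v ∈ L → v ∉ spine → v ∈ r) → b ∈ L → q ∈ L → p ∈ L →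
                 ∃ λ w → IsCycle R w × DifferentVertexSets L w
      shortcut {L} toQ u r∉spine off-spine b∈L q∈L p∈L
        with splitAt toQ (there (off-spine p∈L p∉spine))
      ... | w , l₂ , toP , fromP , eq = w , IsCycle-oneWay toP uw a≢p into-a , witness nondegenerate
        where
        uw++ : Unique (w ++ l₂)
        uw++ = subst Unique eq u

        uw : Unique w
        uw = Unique-++⁻ˡ w uw++

        q∉w : p ≢ q → q ∉ w
        q∉w p≢q q∈w with last∈ fromP
        ... | here q≡p   = p≢q (sym q≡p)
        ... | there q∈l₂ = Unique-++⇒Disjoint w uw++ (q∈w , q∈l₂)

        b∉w : a ≢ b → b ∉ w
        b∉w a≢b b∈w with subst (b ∈_) (sym eq) (∈-++⁺ˡ b∈w)
        ... | here b≡a  = a≢b (sym b≡a)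
        ... | there b∈r = All.lookup r∉spine b∈r (head∈ walk)

        witness : p ≢ q ⊎ a ≢ b → DifferentVertexSets L w
        witness = [ different q∈L ∘ q∉w , different b∈L ∘ b∉w ]′

    converging⇒TwoCycles : TwoCycles R
    converging⇒TwoCycles with simplify _≟_ (strong a p) | detour _≟_ walk unique (strong b q)
    ... | lX , X , uX | L , Z , uZ , reach with different-or-⊆ lX L
    ... | inj₁ X≠Z = lX , L , IsCycle-oneWay X uX a≢p into-a , IsCycle-oneWay Z uZ b≢q into-b , X≠Z
    ... | inj₂ X⊆Z with reach (X⊆Z (head∈ X))
    ... | _ , toQ , u , r∉spine , off-spine
      with shortcut toQ u r∉spine off-spine (head∈ Z) (last∈ Z) (X⊆Z (last∈ X))
    ... | w , W , Z≠W = L , w , IsCycle-oneWay Z uZ b≢q into-b , W , Z≠W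

  module _ {R : Rel (Fin n) 0ℓ} where

    reversal⇒Converging : ∀ {p a b w z M l} →
      Walk (Both R) a b M → OneWay R b w → Walk R w z l → Unique (M ++ l) →
      OneWay (flip R) p a → p ∉ M → p ≢ w ⊎ a ≢ b → Converging (flip R)
    reversal⇒Converging {M = M} seg out rest u into-a p∉M nondegenerate =
      converging (reverseʷ (mapʷ proj₁ seg)) (Unique-reverse (Unique-++⁻ˡ M u))
                 (p∉M ∘ reverse⁻) (w∉M ∘ reverse⁻) into-a out nondegenerate
      where
      w∉M : _ ∉ M
      w∉M w∈M = Unique-++⇒Disjoint M u (w∈M , head∈ rest)

    extendOriented : ∀ {x y z l} → Orientation R x y → Unique (x ∷ l) → Oriented R y z l →
                     Converging (flip R) ⊎ Oriented R x z (x ∷ l)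
    extendOriented (both e)    _ (oriented seg out rest) = inj₂ (oriented (e ∷ seg) out rest)
    extendOriented (along e)   _ o                       = inj₂ (oriented [-] e (Oriented⇒Walk o))
    -- Then x ← y and b → w both leave the bidirected segment y ⇝ b.
    extendOriented (against e) (x∉ ∷ u) (oriented {M = M} seg out rest) =
      inj₁ (reversal⇒Converging seg out rest u e (Allₚ.All¬⇒¬Any (Allₚ.++⁻ˡ M x∉))
                 (inj₁ (All.lookup x∉ (∈-++⁺ʳ M (head∈ rest)))))

    closeOriented : ∀ {x z l} → Oriented R x z l → Orientation R z x → Unique l → 3 ≤ length l →
                    Converging (flip R) ⊎ IsCycle R l
    closeOriented o (both e)  u len = inj₂ (IsCycle-close (Oriented⇒Walk o) u len (proj₁ e))
    closeOriented o (along e) u len = inj₂ (IsCycle-close (Oriented⇒Walk o) u len (proj₁ e))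
    closeOriented {x} {z} (oriented {b} {w} {M} {l} seg out rest) (against e) u len =
      inj₁ (reversal⇒Converging seg out rest u e z∉M nondegenerate)
      where
      z∉M : z ∉ M
      z∉M z∈M = Unique-++⇒Disjoint M u (z∈M , last∈ rest)

      two-vertices : M ≡ [ x ] → l ≡ [ z ] → ⊥
      two-vertices refl refl = case len of λ { (s≤s (s≤s ())) }

      -- z = w and x = b would leave the undirected cycle l with only two vertices.
      nondegenerate : z ≢ w ⊎ x ≢ b
      nondegenerate with z ≟ w
      ... | no z≢w   = inj₁ z≢w
      ... | yes refl = inj₂ λ { refl → two-vertices (loop-unique seg (Unique-++⁻ˡ M u))
                                                    (loop-unique rest (Unique-++⁻ʳ M u)) }

  module _ {E : Rel (Fin n) 0ℓ} where

    data Profile (x z : Fin n) (l : List (Fin n)) : Set where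
      bidirected : Walk (Both E) x z l → Profile x z l
      forward    : Oriented E x z l → Profile x z l
      backward   : Oriented (flip E) x z l → Profile x z l

    ConvergingOrDiverging : Set
    ConvergingOrDiverging = Converging E ⊎ Converging (flip E)

    extendProfile : ∀ {x y z l} → Orientation E x y → Unique (x ∷ l) → Profile y z l →
                    ConvergingOrDiverging ⊎ Profile x z (x ∷ l)
    extendProfile (both e)    _ (bidirected seg) = inj₂ (bidirected (e ∷ seg))
    extendProfile (along e)   _ (bidirected seg) = inj₂ (forward (oriented [-] e (mapʷ proj₁ seg)))
    extendProfile (against e) _ (bidirected seg) = inj₂ (backward (oriented [-] e (mapʷ proj₂ seg)))
    extendProfile o u (forward d)  = Sum.map inj₂ forward (extendOriented o u d)
    extendProfile o u (backward d) = Sum.map inj₁ backward (extendOriented (Orientation-flip o) u d)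

    profile : Decidable E → ∀ {x z l} → Walk (SymClosure E) x z l → Unique l →
              ConvergingOrDiverging ⊎ Profile x z l
    profile E? [-]     _          = inj₂ (bidirected [-])
    profile E? (e ∷ w) u@(_ ∷ u′) = [ inj₁ , extendProfile (orient E? e) u ]′ (profile E? w u′)

    closeProfile : ∀ {x z l} → Profile x z l → Orientation E z x → Unique l → 3 ≤ length l →
            ConvergingOrDiverging ⊎ ∃ λ d → IsCycle E d × SameVertices l d
    closeProfile (bidirected seg) (both e) u len =
      inj₂ (_ , IsCycle-close (mapʷ proj₁ seg) u len (proj₁ e) , SameVertices-refl)
    closeProfile (bidirected seg) (along e) u len =
      inj₂ (_ , IsCycle-close (mapʷ proj₁ seg) u len (proj₁ e) , SameVertices-refl)
    closeProfile (bidirected seg) (against e) u len =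
      inj₂ (_ , IsCycle-flip (IsCycle-close (mapʷ proj₂ seg) u len (proj₁ e)) , SameVertices-reverse)
    closeProfile (forward d) o u len =
      Sum.map inj₂ (λ cycle → _ , cycle , SameVertices-refl) (closeOriented d o u len)
    closeProfile (backward d) o u len =
      Sum.map inj₁ (λ cycle → _ , IsCycle-flip cycle , SameVertices-reverse)
                   (closeOriented d (Orientation-flip o) u len)

    ConvergingOrDiverging⇒TwoCycles : (∀ x y → Star E x y) → ConvergingOrDiverging → TwoCycles E
    ConvergingOrDiverging⇒TwoCycles strong =
      [ converging⇒TwoCycles strong , TwoCycles-flip ∘ converging⇒TwoCycles strong⁻¹ ]′
      where
      strong⁻¹ : ∀ x y → Star (flip E) x y
      strong⁻¹ x y = Star.reverse (λ e → e) (strong y x)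

    cycle-dichotomy : Decidable E → (∀ x y → Star E x y) → ∀ {c} → IsCycle (SymClosure E) c →
                      TwoCycles E ⊎ ∃ λ d → IsCycle E d × SameVertices c d
    cycle-dichotomy E? strong {x ∷ xs} (len , u , lk) with Linked⇒Walk xs lk
    ... | _ , w , e with profile E? w u
    ...   | inj₁ found = inj₁ (ConvergingOrDiverging⇒TwoCycles strong found)
    ...   | inj₂ prof  =
      Sum.map₁ (ConvergingOrDiverging⇒TwoCycles strong) (closeProfile prof (orient E? e) u len)

  TwoCycles-transfer : ∀ {U E : Rel (Fin n) 0ℓ} →
    (∀ {c} → IsCycle U c → TwoCycles E ⊎ ∃ λ d → IsCycle E d × SameVertices c d) →
    TwoCycles U → TwoCycles E
  TwoCycles-transfer realise (c₁ , c₂ , cycle₁ , cycle₂ , c₁≠c₂) with realise cycle₁ | realise cycle₂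
  ... | inj₁ two | _        = two
  ... | inj₂ _   | inj₁ two = two
  ... | inj₂ (d₁ , dcycle₁ , c₁~d₁) | inj₂ (d₂ , dcycle₂ , c₂~d₂) =
    d₁ , d₂ , dcycle₁ , dcycle₂ , DifferentVertexSets-resp c₁~d₁ c₂~d₂ c₁≠c₂

UEdge⇒SymClosure : ∀ {n} (G : Digraph n) → UEdge G ⇒ SymClosure (DEdge G)
UEdge⇒SymClosure G {x} {y} e with G x y in xy
... | true  = fwd xy
... | false = bwd e

DEdge? : ∀ {n} (G : Digraph n) → Decidable (DEdge G)
DEdge? G x y = G x y Bool.≟ true

lemma2p5 : (n : ℕ) (G : Digraph n) → StronglyConnected G →
    (∃₂ λ (c₁ c₂ : List (Fin n)) → IsCycle (UEdge G) c₁ × IsCycle (UEdge G) c₂ × DifferentVertexSets c₁ c₂) →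
    ∃₂ λ (d₁ d₂ : List (Fin n)) → IsCycle (DEdge G) d₁ × IsCycle (DEdge G) d₂ × DifferentVertexSets d₁ d₂
lemma2p5 n G strong =
  TwoCycles-transfer (cycle-dichotomy (DEdge? G) strong ∘ IsCycle-map (UEdge⇒SymClosure G))
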